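{- For every odd integer $n\ge3$, $N(P_{WM(n)})=6^{\frac{n-1}{2}}$.
   Context: For a simple graph $G$ on $[n]$, $P_G=\operatorname{conv}\{\pm(e_i-e_j):\{i,j\}\in E(G)\}\subset\mathbb{R}^n$ is the symmetric edge polytope and $N(P)$ the number of facets of a polytope $P$. For odd $n$, the full windmill $WM(n)$ is the graph on $n$ vertices consisting of $\frac{n-1}{2}$ triangles (3-cycles) all sharing a single common vertex and otherwise disjoint. -}

module Defs where

open import Data.Nat using (ℕ; zero; suc; _+_; _*_; _^_; _≟_)
open import Data.Fin using (Fin; toℕ)
open import Data.Fin.Subset using (Subset; _∈_; _∉_; _⊆_)
open import Data.Rational using (ℚ; 0ℚ; 1ℚ; _≤_) renaming (_+_ to _+ℚ_; _*_ to _*ℚ_; _-_ to _-ℚ_)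
open import Data.List using (List; []; _∷_; _++_; length; concatMap; upTo; lookup)
open import Data.List.Relation.Unary.Unique.Propositional using (Unique)
import Data.List.Membership.Propositional as LM
open import Data.Product using (Σ; ∃; _×_; _,_)
open import Data.Bool using (if_then_else_)
open import Relation.Nullary using (¬_)
open import Relation.Nullary.Decidable using (⌊_⌋)
open import Relation.Binary.PropositionalEquality using (_≡_)
open import Function.Bundles using (_⇔_)

Vecℚ : ℕ → Set
Vecℚ n = Fin n → ℚ

dot : ∀ {n} → Vecℚ n → Vecℚ n → ℚ
dot {zero}  u v = 0ℚ
dot {suc n} u v = (u Fin.zero *ℚ v Fin.zero) +ℚ dot (λ i → u (Fin.suc i)) (λ i → v (Fin.suc i))

basis : (n a : ℕ) → Vecℚ n
basis n a j = if ⌊ toℕ j ≟ a ⌋ then 1ℚ else 0ℚ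

-- A graph on vertex set {0,…,n-1} given by its list of edges {a,b}.
Edge : Set
Edge = ℕ × ℕ

-- Generators ±(e_a - e_b) of the symmetric edge polytope, as a list of points.
sepGens : (n : ℕ) → List Edge → List (Vecℚ n)
sepGens n = concatMap λ { (a , b) →
  (λ j → basis n a j -ℚ basis n b j) ∷ (λ j → basis n b j -ℚ basis n a j) ∷ [] }

-- Points of a polytope conv{S 0,…,S (m-1)} indexed by Fin m.
module Polytope {n m : ℕ} (S : Fin m → Vecℚ n) where

  -- X is a face: the set of generators maximising some linear functional a.
  -- (Every nonempty face of conv S equals conv of the generators it contains.)
  IsFace : Subset m → Set
  IsFace X = Σ (Vecℚ n) λ a → ∀ x → (x ∈ X) ⇔ (∀ t → dot a (S t) ≤ dot a (S x))

  Proper : Subset m → Set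
  Proper X = ∃ λ x → x ∉ X

  IsFacet : Subset m → Set
  IsFacet X = IsFace X × Proper X × (∀ Y → IsFace Y → Proper Y → X ⊆ Y → Y ⊆ X)

  NumFacets≡ : ℕ → Set
  NumFacets≡ N = Σ (List (Subset m)) λ L →
    Unique L × length L ≡ N × (∀ X → (X LM.∈ L) ⇔ IsFacet X)

FacetCountIs : {n : ℕ} → List (Vecℚ n) → ℕ → Set
FacetCountIs gs N = Polytope.NumFacets≡ (lookup gs) N

-- Full windmill WM(2k+1): centre 0, triangles {0, 2i+1, 2i+2} for i < k.
windmillEdges : ℕ → List Edge
windmillEdges k = concatMap (λ i →
  (0 , 1 + 2 * i) ∷ (0 , 2 + 2 * i) ∷ (1 + 2 * i , 2 + 2 * i) ∷ []) (upTo k)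

{-# OPTIONS --safe #-}
module Submission where

-- A functional a meets the six generators ±(e_x - e_y) of a triangle {0, x, y} as the six roots of a
-- hexagon evaluated at (a_x - a_0, a_y - a_0), and these k points of the plane can be chosen
-- independently. The generators are centrally symmetric, so a proper face has a positive maximum M,
-- and on each triangle the generators attaining M lie on a single edge of the hexagon. Hence every
-- facet is contained in, and by maximality equal to, the set of generators lying on a chosen edge σ i
-- of the i-th hexagon for every i. Conversely each of these 6^k sets is the face cut out by the
-- functional that is the outer normal of σ i on triangle i, and any face containing it is cut out by a
-- positive multiple of that functional, which makes it a facet.

open import Defs
open import Data.Nat using (ℕ; zero; suc; s≤s; z<s; _+_; _*_; _^_; _≤_; _<_)
import Data.Nat.Properties as ℕ
open import Data.Bool using (if_then_else_)
open import Data.Bool.Properties using (T-≡)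
open import Data.Fin using (Fin; zero; suc; toℕ; fromℕ<; _↑ʳ_; combine; funToFin; finToFun)
open import Data.Fin.Patterns
open import Data.Fin.Properties using (all?; any?; toℕ<n; funToFin-finToFin; finToFun-funToFin) renaming (_≟_ to _≟ᶠ_)
open import Data.Fin.Subset using (Subset; _∈_; _∉_; _⊆_)
open import Data.Fin.Subset.Properties using (_∈?_; anySubset?; ⊆-antisym)
open import Data.List using (List; []; _∷_; length; concatMap; applyUpTo; lookup; allFin)
import Data.List as List
open import Data.List.Properties using (length-tabulate)
open import Data.List.Membership.Propositional using () renaming (_∈_ to _∈ₗ_)
open import Data.List.Membership.Propositional.Properties using (∈-tabulate⁺; ∈-tabulate⁻; ∈-allFin)
import Data.List.Relation.Unary.All as All
open import Data.List.Relation.Unary.Unique.Propositional.Properties using (tabulate⁺)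
open import Data.Product using (_×_; _,_; ∃; proj₁; proj₂)
open import Data.Sum using (_⊎_; inj₁; inj₂)
open import Data.Vec using (tabulate)
open import Data.Vec.Properties using (lookup∘tabulate; []=⇒lookup; lookup⇒[]=; tabulate-cong)
open import Data.Rational using (ℚ; 0ℚ; 1ℚ; -_; Positive; positive)
  renaming (_+_ to _+ℚ_; _*_ to _*ℚ_; _-_ to _-ℚ_; _≤_ to _≤ℚ_; _<_ to _<ℚ_)
import Data.Rational.Properties as ℚ
open import Data.Rational.Solver using (module +-*-Solver)
open import Function using (_∘_; id)
open import Function.Bundles using (_⇔_; mk⇔; Equivalence)
open import Relation.Unary using (Pred; Decidable)
open import Relation.Nullary using (¬?)
open import Relation.Nullary.Decidable
  using (⌊_⌋; isYes≗does; toWitness; fromWitness; _→-dec_; _⊎-dec_; decidable-stable; from-no; from-yes)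
open import Relation.Binary.Bundles using (DecTotalOrder)
open import Data.List.Extrema (DecTotalOrder.totalOrder ℚ.≤-decTotalOrder) using (argmax; f[xs]≤f[argmax])
open import Relation.Binary.PropositionalEquality
open ≡-Reasoning
open +-*-Solver
open Equivalence using (to; from)

x≡M⇒x≡M*1 : ∀ {x M} → x ≡ M → x ≡ M *ℚ 1ℚ
x≡M⇒x≡M*1 {x} {M} x≡M = trans x≡M (sym (ℚ.*-identityʳ M))

-x≡M⇒x≡M*-1 : ∀ {x M} → - x ≡ M → x ≡ M *ℚ - 1ℚ
-x≡M⇒x≡M*-1 {x} {M} -x≡M = trans (solve 1 (λ x → x := (:- x) :* (:- con 1ℚ)) refl x) (cong (_*ℚ - 1ℚ) -x≡M)

x≡M⇒y≡M⇒x-y≡M*0 : ∀ {x y M} → x ≡ M → y ≡ M → x -ℚ y ≡ M *ℚ 0ℚ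
x≡M⇒y≡M⇒x-y≡M*0 {M = M} refl refl = solve 1 (λ M → M :- M := M :* con 0ℚ) refl M

0<M⇒M<M+M : ∀ {M} → 0ℚ <ℚ M → M <ℚ M +ℚ M
0<M⇒M<M+M {M} 0<M = subst (_<ℚ M +ℚ M) (ℚ.+-identityʳ M) (ℚ.+-monoʳ-< M 0<M)

0<M⇒-M≢M : ∀ {M} → 0ℚ <ℚ M → - M ≢ M
0<M⇒-M≢M 0<M -M≡M = ℚ.<-irrefl -M≡M (ℚ.<-trans (ℚ.neg-antimono-< 0<M) 0<M)

sub-anticomm : ∀ x y → x -ℚ y ≡ - (y -ℚ x)
sub-anticomm = solve 2 (λ x y → x :- y := :- (y :- x)) refl

sub-shift : ∀ x y z → x -ℚ y ≡ (x -ℚ z) -ℚ (y -ℚ z)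
sub-shift = solve 3 (λ x y z → x :- y := (x :- z) :- (y :- z)) refl

-p≤q≤0⇒q≤p : ∀ {p q} → - p ≤ℚ q → q ≤ℚ 0ℚ → q ≤ℚ p
-p≤q≤0⇒q≤p {p} {q} -p≤q q≤0 = ℚ.≤-trans q≤0 (ℚ.≤-trans (ℚ.neg-antimono-≤ q≤0) -q≤p)
  where
  -q≤p : - q ≤ℚ p
  -q≤p = subst (- q ≤ℚ_) (solve 1 (λ p → :- (:- p) := p) refl p) (ℚ.neg-antimono-≤ -p≤q)

*-cancelˡ-≡-pos : ∀ {r p q} → 0ℚ <ℚ r → r *ℚ p ≡ r *ℚ q → p ≡ q
*-cancelˡ-≡-pos {r} 0<r rp≡rq = ℚ.≤-antisym (cancel (ℚ.≤-reflexive rp≡rq)) (cancel (ℚ.≤-reflexive (sym rp≡rq)))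
  where
  instance
    r-positive : Positive r
    r-positive = positive 0<r
  cancel : ∀ {p q} → r *ℚ p ≤ℚ r *ℚ q → p ≤ℚ q
  cancel = ℚ.*-cancelˡ-≤-pos r

dot-cong : ∀ {n} (a : Vecℚ n) {u v : Vecℚ n} → u ≗ v → dot a u ≡ dot a v
dot-cong {zero}  a u≗v = refl
dot-cong {suc n} a u≗v = cong₂ _+ℚ_ (cong (a zero *ℚ_) (u≗v zero)) (dot-cong (a ∘ suc) (u≗v ∘ suc))

dot-zeroʳ : ∀ {n} (a : Vecℚ n) → dot a (λ _ → 0ℚ) ≡ 0ℚ
dot-zeroʳ {zero}  a = refl
dot-zeroʳ {suc n} a = cong₂ _+ℚ_ (ℚ.*-zeroʳ (a zero)) (dot-zeroʳ (a ∘ suc))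

dot-sub : ∀ {n} (a u v : Vecℚ n) → dot a (λ j → u j -ℚ v j) ≡ dot a u -ℚ dot a v
dot-sub {zero}  a u v = refl
dot-sub {suc n} a u v = begin
  a₀ *ℚ (u₀ -ℚ v₀) +ℚ dot (a ∘ suc) (λ j → u (suc j) -ℚ v (suc j))
    ≡⟨ cong (a₀ *ℚ (u₀ -ℚ v₀) +ℚ_) (dot-sub (a ∘ suc) (u ∘ suc) (v ∘ suc)) ⟩
  a₀ *ℚ (u₀ -ℚ v₀) +ℚ (U -ℚ V)
    ≡⟨ solve 5 (λ a₀ u₀ v₀ U V → a₀ :* (u₀ :- v₀) :+ (U :- V) := (a₀ :* u₀ :+ U) :- (a₀ :* v₀ :+ V)) refl a₀ u₀ v₀ U V ⟩
  (a₀ *ℚ u₀ +ℚ U) -ℚ (a₀ *ℚ v₀ +ℚ V) ∎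
  where
  a₀ u₀ v₀ U V : ℚ
  a₀ = a zero
  u₀ = u zero
  v₀ = v zero
  U = dot (a ∘ suc) (u ∘ suc)
  V = dot (a ∘ suc) (v ∘ suc)

-- `basis` tests equality with the strict `isYes`, which does not compute on open terms.
basis-suc : ∀ n x (j : Fin n) → basis (suc n) (suc x) (suc j) ≡ basis n x j
basis-suc n x j = cong (if_then 1ℚ else 0ℚ)
  (trans (isYes≗does (suc (toℕ j) ℕ.≟ suc x)) (sym (isYes≗does (toℕ j ℕ.≟ x))))

dot-basis : ∀ {n} (f : ℕ → ℚ) x → x < n → dot {n} (f ∘ toℕ) (basis n x) ≡ f x
dot-basis {suc n} f zero    _         = begin
  f 0 *ℚ 1ℚ +ℚ dot {n} (f ∘ suc ∘ toℕ) (λ _ → 0ℚ) ≡⟨ cong₂ _+ℚ_ (ℚ.*-identityʳ (f 0)) (dot-zeroʳ {n} _) ⟩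
  f 0 +ℚ 0ℚ                                        ≡⟨ ℚ.+-identityʳ (f 0) ⟩
  f 0                                              ∎
dot-basis {suc n} f (suc x) (s≤s x<n) = begin
  f 0 *ℚ 0ℚ +ℚ dot (f ∘ suc ∘ toℕ) (basis (suc n) (suc x) ∘ suc)
    ≡⟨ cong (f 0 *ℚ 0ℚ +ℚ_) (dot-cong (f ∘ suc ∘ toℕ) (basis-suc n x)) ⟩
  f 0 *ℚ 0ℚ +ℚ dot (f ∘ suc ∘ toℕ) (basis n x)
    ≡⟨ cong₂ _+ℚ_ (ℚ.*-zeroʳ (f 0)) (dot-basis (f ∘ suc) x x<n) ⟩
  0ℚ +ℚ f (suc x)
    ≡⟨ ℚ.+-identityˡ (f (suc x)) ⟩
  f (suc x) ∎

select : ∀ {m p} {P : Pred (Fin m) p} → Decidable P → Subset m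
select P? = tabulate (λ t → ⌊ P? t ⌋)

∈-select : ∀ {m p} {P : Pred (Fin m) p} (P? : Decidable P) {t} → t ∈ select P? ⇔ P t
∈-select P? {t} = mk⇔
  (λ t∈ → toWitness (from T-≡ (trans (sym (lookup∘tabulate _ t)) ([]=⇒lookup t∈))))
  (λ Pt → lookup⇒[]= t _ (trans (lookup∘tabulate _ t) (to T-≡ (fromWitness Pt))))

funToFin-cong : ∀ {m n} {f g : Fin m → Fin n} → f ≗ g → funToFin f ≡ funToFin g
funToFin-cong {zero}  f≗g = refl
funToFin-cong {suc m} f≗g = cong₂ combine (f≗g zero) (funToFin-cong (f≗g ∘ suc))

Plane : Set
Plane = ℚ × ℚ

infixr 7 _·_
_·_ : ℚ → Plane → Plane
c · (u , v) = c *ℚ u , c *ℚ v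

-- root p (u , v) is the value of a functional a on the p-th generator ±(e_x - e_y) of a triangle {0, x, y},
-- where u = a_x - a_0 and v = a_y - a_0; the six generators are numbered in cyclic order around their hexagon.
root : Fin 6 → Plane → ℚ
root 0F (u , v) = u
root 1F (u , v) = u -ℚ v
root 2F (u , v) = - v
root 3F (u , v) = - u
root 4F (u , v) = v -ℚ u
root 5F (u , v) = v

next : Fin 6 → Fin 6
next 0F = 1F
next 1F = 2F
next 2F = 3F
next 3F = 4F
next 4F = 5F
next 5F = 0F

opposite : Fin 6 → Fin 6
opposite p = next (next (next p))

OnEdge : Fin 6 → Fin 6 → Set
OnEdge s p = p ≡ s ⊎ p ≡ next s

-- The outer normal of the hexagon edge joining the roots s and next s.
normal : Fin 6 → Plane
normal 0F = 1ℚ , 0ℚ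
normal 1F = 0ℚ , - 1ℚ
normal 2F = - 1ℚ , - 1ℚ
normal 3F = - 1ℚ , 0ℚ
normal 4F = 0ℚ , 1ℚ
normal 5F = 1ℚ , 1ℚ

root-· : ∀ p c w → root p (c · w) ≡ c *ℚ root p w
root-· 0F c (u , v) = refl
root-· 1F c (u , v) = solve 3 (λ c u v → c :* u :- c :* v := c :* (u :- v)) refl c u v
root-· 2F c (u , v) = solve 2 (λ c v → :- (c :* v) := c :* (:- v)) refl c v
root-· 3F c (u , v) = solve 2 (λ c u → :- (c :* u) := c :* (:- u)) refl c u
root-· 4F c (u , v) = solve 3 (λ c u v → c :* v :- c :* u := c :* (v :- u)) refl c u v
root-· 5F c (u , v) = refl

root-next : ∀ p w → root (next p) w ≡ root p w +ℚ root (next (next p)) w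
root-next 0F (u , v) = solve 2 (λ u v → u :- v := u :+ (:- v)) refl u v
root-next 1F (u , v) = solve 2 (λ u v → :- v := (u :- v) :+ (:- u)) refl u v
root-next 2F (u , v) = solve 2 (λ u v → :- u := (:- v) :+ (v :- u)) refl u v
root-next 3F (u , v) = solve 2 (λ u v → v :- u := (:- u) :+ v) refl u v
root-next 4F (u , v) = solve 2 (λ u v → v := (v :- u) :+ u) refl u v
root-next 5F (u , v) = solve 2 (λ u v → u := v :+ (u :- v)) refl u v

root-opposite : ∀ p w → root (opposite p) w ≡ - root p w
root-opposite 0F (u , v) = refl
root-opposite 1F (u , v) = solve 2 (λ u v → v :- u := :- (u :- v)) refl u v
root-opposite 2F (u , v) = solve 1 (λ v → v := :- (:- v)) refl v
root-opposite 3F (u , v) = solve 1 (λ u → u := :- (:- u)) refl u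
root-opposite 4F (u , v) = solve 2 (λ u v → u :- v := :- (v :- u)) refl u v
root-opposite 5F (u , v) = refl

root-normal-≤1 : ∀ s p → root p (normal s) ≤ℚ 1ℚ
root-normal-≤1 = from-yes (all? λ s → all? λ p → root p (normal s) ℚ.≤? 1ℚ)

root-normal-onEdge : ∀ s p → OnEdge s p → root p (normal s) ≡ 1ℚ
root-normal-onEdge = from-yes (all? λ s → all? λ p → (p ≟ᶠ s ⊎-dec p ≟ᶠ next s) →-dec root p (normal s) ℚ.≟ 1ℚ)

root-opposite-normal : ∀ s → root (opposite s) (normal s) ≢ 1ℚ
root-opposite-normal = from-yes (all? λ s → ¬? (root (opposite s) (normal s) ℚ.≟ 1ℚ))

edge-determined : ∀ s t → root s (normal t) ≡ 1ℚ → root (next s) (normal t) ≡ 1ℚ → s ≡ t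
edge-determined = from-yes (all? λ s → all? λ t →
  root s (normal t) ℚ.≟ 1ℚ →-dec root (next s) (normal t) ℚ.≟ 1ℚ →-dec s ≟ᶠ t)

edge-rigid : ∀ s w M → root s w ≡ M → root (next s) w ≡ M → w ≡ M · normal s
edge-rigid 0F (u , v) M e₁ e₂ = cong₂ _,_
  (x≡M⇒x≡M*1 e₁)
  (trans (solve 2 (λ u v → v := u :- (u :- v)) refl u v) (x≡M⇒y≡M⇒x-y≡M*0 e₁ e₂))
edge-rigid 1F (u , v) M e₁ e₂ = cong₂ _,_
  (trans (solve 2 (λ u v → u := (u :- v) :- (:- v)) refl u v) (x≡M⇒y≡M⇒x-y≡M*0 e₁ e₂))
  (-x≡M⇒x≡M*-1 e₂)
edge-rigid 2F (u , v) M e₁ e₂ = cong₂ _,_ (-x≡M⇒x≡M*-1 e₂) (-x≡M⇒x≡M*-1 e₁)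
edge-rigid 3F (u , v) M e₁ e₂ = cong₂ _,_
  (-x≡M⇒x≡M*-1 e₁)
  (trans (solve 2 (λ u v → v := (v :- u) :- (:- u)) refl u v) (x≡M⇒y≡M⇒x-y≡M*0 e₂ e₁))
edge-rigid 4F (u , v) M e₁ e₂ = cong₂ _,_
  (trans (solve 2 (λ u v → u := v :- (v :- u)) refl u v) (x≡M⇒y≡M⇒x-y≡M*0 e₂ e₁))
  (x≡M⇒x≡M*1 e₂)
edge-rigid 5F (u , v) M e₁ e₂ = cong₂ _,_ (x≡M⇒x≡M*1 e₂) (x≡M⇒x≡M*1 e₁)

-- Checked by running through all 64 subsets of the hexagon's vertices.
edge-cover : ∀ (Z : Subset 6) → (∀ q → q ∈ Z → next (next q) ∉ Z) → (∀ q → q ∈ Z → opposite q ∉ Z) →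
             ∃ λ s → ∀ q → q ∈ Z → OnEdge s q
edge-cover Z = decidable-stable (covered? Z) λ ¬covered → from-no (anySubset? (¬? ∘ covered?)) (Z , ¬covered)
  where
  Covered : Subset 6 → Set
  Covered Z = (∀ q → q ∈ Z → next (next q) ∉ Z) → (∀ q → q ∈ Z → opposite q ∉ Z) →
              ∃ λ s → ∀ q → q ∈ Z → OnEdge s q
  covered? : Decidable Covered
  covered? Z = all? (λ q → q ∈? Z →-dec ¬? (next (next q) ∈? Z))
         →-dec all? (λ q → q ∈? Z →-dec ¬? (opposite q ∈? Z))
         →-dec any? (λ s → all? λ q → q ∈? Z →-dec (q ≟ᶠ s ⊎-dec q ≟ᶠ next s))

-- A positive maximum is attained neither at two opposite roots (they sum to 0) nor at the two
-- neighbours of a root (they sum to that root), so it is attained only on one edge.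
maximizers-on-edge : ∀ w M → 0ℚ <ℚ M → (∀ p → root p w ≤ℚ M) → ∃ λ s → ∀ p → root p w ≡ M → OnEdge s p
maximizers-on-edge w M 0<M bound =
  let s , covers = edge-cover (select attains?) no-flank no-opposite
  in s , λ p → covers p ∘ from (∈-select attains?)
  where
  attains? : Decidable (λ p → root p w ≡ M)
  attains? p = root p w ℚ.≟ M
  attains : ∀ {q} → q ∈ select attains? → root q w ≡ M
  attains = to (∈-select attains?)
  no-flank : ∀ q → q ∈ select attains? → next (next q) ∉ select attains?
  no-flank q q∈ q″∈ = ℚ.<-irrefl refl (ℚ.<-≤-trans (0<M⇒M<M+M 0<M)
    (subst (_≤ℚ M) (trans (root-next q w) (cong₂ _+ℚ_ (attains q∈) (attains q″∈))) (bound (next q))))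
  no-opposite : ∀ q → q ∈ select attains? → opposite q ∉ select attains?
  no-opposite q q∈ q‴∈ = 0<M⇒-M≢M 0<M (trans (cong -_ (sym (attains q∈))) (trans (sym (root-opposite q w)) (attains q‴∈)))

module Faces {n m : ℕ} (S : Fin m → Vecℚ n) where
  open Polytope S

  Maximizes : Vecℚ n → Fin m → Set
  Maximizes a x = ∀ t → dot a (S t) ≤ℚ dot a (S x)

  maximizer-exists : Fin m → (a : Vecℚ n) → ∃ (Maximizes a)
  maximizer-exists t₀ a = argmax value t₀ (allFin m) , λ t → All.lookup (f[xs]≤f[argmax] t₀ (allFin m)) (∈-allFin t)
    where
    value : Fin m → ℚ
    value t = dot a (S t)

  face-value-constant : ∀ {X} (face : IsFace X) {x y} → x ∈ X → y ∈ X → dot (proj₁ face) (S x) ≡ dot (proj₁ face) (S y)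
  face-value-constant (a , ha) {x} {y} x∈X y∈X = ℚ.≤-antisym (to (ha y) y∈X x) (to (ha x) x∈X y)

  levelSet : Vecℚ n → ℚ → Subset m
  levelSet a c = select (λ t → dot a (S t) ℚ.≟ c)

  ∈-levelSet : ∀ a c {t} → t ∈ levelSet a c ⇔ dot a (S t) ≡ c
  ∈-levelSet a c = ∈-select _

  levelSet-cong : ∀ a b c → (∀ t → dot a (S t) ≡ dot b (S t)) → levelSet a c ≡ levelSet b c
  levelSet-cong a b c a≗b = tabulate-cong (λ t → cong (λ z → ⌊ z ℚ.≟ c ⌋) (a≗b t))

  levelSet-isFace : ∀ a c x → dot a (S x) ≡ c → (∀ t → dot a (S t) ≤ℚ c) → IsFace (levelSet a c)
  levelSet-isFace a c x ax≡c bound = a , λ y → mk⇔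
    (λ y∈ t → subst (dot a (S t) ≤ℚ_) (sym (to (∈-levelSet a c) y∈)) (bound t))
    (λ y-max → from (∈-levelSet a c) (ℚ.≤-antisym (bound y) (subst (_≤ℚ dot a (S y)) ax≡c (y-max x))))

  CentrallySymmetric : Set
  CentrallySymmetric = ∀ t → ∃ λ t′ → ∀ a → dot a (S t′) ≡ - dot a (S t)

  -- If the maximum were ≤ 0, every generator t would attain it, since -(a·t) is also a value.
  proper-face-positive : CentrallySymmetric → ∀ {X} (face : IsFace X) → Proper X →
                         ∀ {x} → x ∈ X → 0ℚ <ℚ dot (proj₁ face) (S x)
  proper-face-positive symmetric (a , ha) (y , y∉X) {x} x∈X = ℚ.≰⇒> λ ax≤0 → y∉X (from (ha y) (y-max ax≤0))
    where
    x-max : Maximizes a x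
    x-max = to (ha x) x∈X
    y-max : dot a (S x) ≤ℚ 0ℚ → Maximizes a y
    y-max ax≤0 t = let y′ , y′≡-y = symmetric y in
      ℚ.≤-trans (x-max t) (-p≤q≤0⇒q≤p (subst (_≤ℚ dot a (S x)) (y′≡-y a) (x-max y′)) ax≤0)

  numFacets-enumerated : ∀ {N} (F : Fin N → Subset m) → (∀ {c d} → F c ≡ F d → c ≡ d) →
                         (∀ c → IsFacet (F c)) → (∀ X → IsFacet X → ∃ λ c → X ≡ F c) → NumFacets≡ N
  numFacets-enumerated F F-injective F-facet facet-F =
    List.tabulate F , tabulate⁺ F-injective , length-tabulate F , λ X → mk⇔
      (λ X∈ → let c , X≡Fc = ∈-tabulate⁻ X∈ in subst IsFacet (sym X≡Fc) (F-facet c))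
      (λ X-facet → let c , X≡Fc = facet-F X X-facet in subst (_∈ₗ List.tabulate F) (sym X≡Fc) (∈-tabulate⁺ c))

triangle : ℕ → List Edge
triangle i = (0 , 1 + 2 * i) ∷ (0 , 2 + 2 * i) ∷ (1 + 2 * i , 2 + 2 * i) ∷ []

module WindmillGenerators (n : ℕ) where

  -- Triangles labelled f 0, …, f (k - 1); the windmill is f = id, and the general f makes induction on k possible.
  generators : (ℕ → ℕ) → ℕ → List (Vecℚ n)
  generators f k = sepGens n (concatMap triangle (applyUpTo f k))

  Index : (ℕ → ℕ) → ℕ → Set
  Index f k = Fin (length (generators f k))

  coord : Vecℚ n → ℕ → ℚ
  coord a x = dot a (basis n x)

  triangleCoords : Vecℚ n → ℕ → Plane
  triangleCoords a i = coord a (1 + 2 * i) -ℚ coord a 0 , coord a (2 + 2 * i) -ℚ coord a 0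

  -- sepGens lists a triangle's generators as e_0 - e_x, e_x - e_0, e_0 - e_y, e_y - e_0, e_x - e_y, e_y - e_x,
  -- which are the roots 3, 0, 2, 5, 1, 4.
  indexOf : ∀ f k → Fin k → Fin 6 → Index f k
  indexOf f (suc k) zero 0F = 1F
  indexOf f (suc k) zero 1F = 4F
  indexOf f (suc k) zero 2F = 2F
  indexOf f (suc k) zero 3F = 0F
  indexOf f (suc k) zero 4F = 5F
  indexOf f (suc k) zero 5F = 3F
  indexOf f (suc k) (suc i) p = 6 ↑ʳ indexOf (f ∘ suc) k i p

  indexOf-induction : ∀ f k {ℓ} {P : Index f k → Set ℓ} → (∀ i p → P (indexOf f k i p)) → ∀ t → P t
  indexOf-induction f (suc k) P-at 0F = P-at zero 3F
  indexOf-induction f (suc k) P-at 1F = P-at zero 0F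
  indexOf-induction f (suc k) P-at 2F = P-at zero 2F
  indexOf-induction f (suc k) P-at 3F = P-at zero 5F
  indexOf-induction f (suc k) P-at 4F = P-at zero 1F
  indexOf-induction f (suc k) P-at 5F = P-at zero 4F
  indexOf-induction f (suc k) P-at (suc (suc (suc (suc (suc (suc t)))))) = indexOf-induction (f ∘ suc) k (P-at ∘ suc) t

  dot-indexOf : ∀ f k a i p → dot a (lookup (generators f k) (indexOf f k i p)) ≡ root p (triangleCoords a (f (toℕ i)))
  dot-indexOf f (suc k) a zero 0F = dot-sub a _ _
  dot-indexOf f (suc k) a zero 1F = trans (dot-sub a _ _) (sub-shift (coord a (1 + 2 * f 0)) (coord a (2 + 2 * f 0)) (coord a 0))
  dot-indexOf f (suc k) a zero 2F = trans (dot-sub a _ _) (sub-anticomm (coord a 0) (coord a (2 + 2 * f 0)))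
  dot-indexOf f (suc k) a zero 3F = trans (dot-sub a _ _) (sub-anticomm (coord a 0) (coord a (1 + 2 * f 0)))
  dot-indexOf f (suc k) a zero 4F = trans (dot-sub a _ _) (sub-shift (coord a (2 + 2 * f 0)) (coord a (1 + 2 * f 0)) (coord a 0))
  dot-indexOf f (suc k) a zero 5F = dot-sub a _ _
  dot-indexOf f (suc k) a (suc i) p = dot-indexOf (f ∘ suc) k a i p

  generators-symmetric : ∀ f k → Faces.CentrallySymmetric (lookup (generators f k))
  generators-symmetric f k = indexOf-induction f k λ i p → indexOf f k i (opposite p) , λ a → begin
    dot a (lookup (generators f k) (indexOf f k i (opposite p))) ≡⟨ dot-indexOf f k a i (opposite p) ⟩
    root (opposite p) (triangleCoords a (f (toℕ i)))             ≡⟨ root-opposite p _ ⟩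
    - root p (triangleCoords a (f (toℕ i)))                      ≡⟨ cong -_ (dot-indexOf f k a i p) ⟨
    - dot a (lookup (generators f k) (indexOf f k i p))          ∎

vertexValue : ∀ {k} → (Fin k → Plane) → ℕ → ℚ
vertexValue         w zero                = 0ℚ
vertexValue {zero}  w (suc x)             = 0ℚ
vertexValue {suc k} w (suc zero)          = proj₁ (w zero)
vertexValue {suc k} w (suc (suc zero))    = proj₂ (w zero)
vertexValue {suc k} w (suc (suc (suc x))) = vertexValue (w ∘ suc) (suc x)

vertexValue-triangle : ∀ {k} (w : Fin k → Plane) i → (vertexValue w (1 + 2 * toℕ i) , vertexValue w (2 + 2 * toℕ i)) ≡ w i
vertexValue-triangle w zero    = refl
vertexValue-triangle w (suc i) rewrite ℕ.*-suc 2 (toℕ i) = vertexValue-triangle (w ∘ suc) i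

module Windmill (k : ℕ) (1≤k : 1 ≤ k) where
  n : ℕ
  n = 1 + 2 * k

  open WindmillGenerators n

  S : Index id k → Vecℚ n
  S = lookup (generators id k)

  open Polytope S
  open Faces S

  i₀ : Fin k
  i₀ = fromℕ< 1≤k

  outer<n : ∀ (i : Fin k) → 2 + 2 * toℕ i < n
  outer<n i = s≤s (subst (_≤ 2 * k) (ℕ.*-suc 2 (toℕ i)) (ℕ.*-monoʳ-≤ 2 (toℕ<n i)))

  realise : (Fin k → Plane) → Vecℚ n
  realise w = vertexValue w ∘ toℕ

  triangleCoords-realise : ∀ w i → triangleCoords (realise w) (toℕ i) ≡ w i
  triangleCoords-realise w i = begin
    (coord (realise w) x -ℚ coord (realise w) 0 , coord (realise w) y -ℚ coord (realise w) 0)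
      ≡⟨ cong₂ _,_ (cong₂ _-ℚ_ (dot-basis {n} (vertexValue w) x (ℕ.<-trans (ℕ.n<1+n x) (outer<n i))) centre)
                   (cong₂ _-ℚ_ (dot-basis {n} (vertexValue w) y (outer<n i)) centre) ⟩
    (vertexValue w x -ℚ 0ℚ , vertexValue w y -ℚ 0ℚ)
      ≡⟨ cong₂ _,_ (ℚ.+-identityʳ (vertexValue w x)) (ℚ.+-identityʳ (vertexValue w y)) ⟩
    (vertexValue w x , vertexValue w y)
      ≡⟨ vertexValue-triangle w i ⟩
    w i ∎
    where
    x y : ℕ
    x = 1 + 2 * toℕ i
    y = 2 + 2 * toℕ i
    centre : coord (realise w) 0 ≡ 0ℚ
    centre = dot-basis {n} (vertexValue w) 0 z<s

  dot-realise : ∀ w i p → dot (realise w) (S (indexOf id k i p)) ≡ root p (w i)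
  dot-realise w i p = trans (dot-indexOf id k (realise w) i p) (cong (root p) (triangleCoords-realise w i))

  facetNormal : (Fin k → Fin 6) → Vecℚ n
  facetNormal σ = realise (normal ∘ σ)

  dot-facetNormal : ∀ σ i p → dot (facetNormal σ) (S (indexOf id k i p)) ≡ root p (normal (σ i))
  dot-facetNormal σ = dot-realise (normal ∘ σ)

  facetOf : (Fin k → Fin 6) → Subset (length (generators id k))
  facetOf σ = levelSet (facetNormal σ) 1ℚ

  ∈-facetOf : ∀ σ i p → indexOf id k i p ∈ facetOf σ ⇔ root p (normal (σ i)) ≡ 1ℚ
  ∈-facetOf σ i p = mk⇔ (λ t∈ → trans (sym (dot-facetNormal σ i p)) (to (∈-levelSet (facetNormal σ) 1ℚ) t∈))
                        (λ on → from (∈-levelSet (facetNormal σ) 1ℚ) (trans (dot-facetNormal σ i p) on))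

  onEdge-∈-facetOf : ∀ σ i p → OnEdge (σ i) p → indexOf id k i p ∈ facetOf σ
  onEdge-∈-facetOf σ i p on = from (∈-facetOf σ i p) (root-normal-onEdge (σ i) p on)

  facetOf-cong : ∀ {σ τ} → σ ≗ τ → facetOf σ ≡ facetOf τ
  facetOf-cong {σ} {τ} σ≗τ = levelSet-cong (facetNormal σ) (facetNormal τ) 1ℚ same-values
    where
    same-values : ∀ t → dot (facetNormal σ) (S t) ≡ dot (facetNormal τ) (S t)
    same-values = indexOf-induction id k λ i p → begin
      dot (facetNormal σ) (S (indexOf id k i p)) ≡⟨ dot-facetNormal σ i p ⟩
      root p (normal (σ i))                       ≡⟨ cong (root p ∘ normal) (σ≗τ i) ⟩
      root p (normal (τ i))                       ≡⟨ dot-facetNormal τ i p ⟨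
      dot (facetNormal τ) (S (indexOf id k i p))  ∎

  facetOf-isFace : ∀ σ → IsFace (facetOf σ)
  facetOf-isFace σ = levelSet-isFace (facetNormal σ) 1ℚ (indexOf id k i₀ (σ i₀))
    (trans (dot-facetNormal σ i₀ (σ i₀)) (root-normal-onEdge (σ i₀) (σ i₀) (inj₁ refl))) bound
    where
    bound : ∀ t → dot (facetNormal σ) (S t) ≤ℚ 1ℚ
    bound = indexOf-induction id k λ i p → subst (_≤ℚ 1ℚ) (sym (dot-facetNormal σ i p)) (root-normal-≤1 (σ i) p)

  facetOf-proper : ∀ σ → Proper (facetOf σ)
  facetOf-proper σ = indexOf id k i₀ (opposite (σ i₀)) , root-opposite-normal (σ i₀) ∘ to (∈-facetOf σ i₀ _)

  -- A face Y through facetOf σ has, on each triangle, its maximum M at both roots of the edge σ i,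
  -- so its functional agrees with M times the one defining facetOf σ.
  facetOf-maximal : ∀ σ Y → IsFace Y → Proper Y → facetOf σ ⊆ Y → Y ⊆ facetOf σ
  facetOf-maximal σ Y Y-face@(b , _) Y-proper facetOf⊆Y {x} x∈Y =
    from (∈-levelSet (facetNormal σ) 1ℚ) (*-cancelˡ-≡-pos 0<M (begin
      M *ℚ dot (facetNormal σ) (S x) ≡⟨ b-scaled x ⟨
      dot b (S x)                    ≡⟨ face-value-constant Y-face x∈Y t₀∈Y ⟩
      M                              ≡⟨ ℚ.*-identityʳ M ⟨
      M *ℚ 1ℚ                        ∎))
    where
    t₀∈Y : indexOf id k i₀ (σ i₀) ∈ Y
    t₀∈Y = facetOf⊆Y (onEdge-∈-facetOf σ i₀ (σ i₀) (inj₁ refl))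
    M : ℚ
    M = dot b (S (indexOf id k i₀ (σ i₀)))
    0<M : 0ℚ <ℚ M
    0<M = proper-face-positive (generators-symmetric id k) Y-face Y-proper t₀∈Y
    edge-value : ∀ i p → OnEdge (σ i) p → root p (triangleCoords b (toℕ i)) ≡ M
    edge-value i p on = trans (sym (dot-indexOf id k b i p))
      (face-value-constant Y-face (facetOf⊆Y (onEdge-∈-facetOf σ i p on)) t₀∈Y)
    b-scaled : ∀ t → dot b (S t) ≡ M *ℚ dot (facetNormal σ) (S t)
    b-scaled = indexOf-induction id k λ i p → begin
      dot b (S (indexOf id k i p))                    ≡⟨ dot-indexOf id k b i p ⟩
      root p (triangleCoords b (toℕ i))
        ≡⟨ cong (root p) (edge-rigid (σ i) _ M (edge-value i (σ i) (inj₁ refl)) (edge-value i (next (σ i)) (inj₂ refl))) ⟩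
      root p (M · normal (σ i))                       ≡⟨ root-· p M (normal (σ i)) ⟩
      M *ℚ root p (normal (σ i))                      ≡⟨ cong (M *ℚ_) (dot-facetNormal σ i p) ⟨
      M *ℚ dot (facetNormal σ) (S (indexOf id k i p)) ∎

  facetOf-isFacet : ∀ σ → IsFacet (facetOf σ)
  facetOf-isFacet σ = facetOf-isFace σ , facetOf-proper σ , facetOf-maximal σ

  facet-is-facetOf : ∀ X → IsFacet X → ∃ λ σ → X ≡ facetOf σ
  facet-is-facetOf X (X-face@(a , ha) , X-proper@(x , _) , X-maximal) =
    σ , ⊆-antisym X⊆facetOf (X-maximal (facetOf σ) (facetOf-isFace σ) (facetOf-proper σ) X⊆facetOf)
    where
    x₀ : Index id k
    x₀ = proj₁ (maximizer-exists x a)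
    x₀-max : Maximizes a x₀
    x₀-max = proj₂ (maximizer-exists x a)
    x₀∈X : x₀ ∈ X
    x₀∈X = from (ha x₀) x₀-max
    M : ℚ
    M = dot a (S x₀)
    bound : ∀ i p → root p (triangleCoords a (toℕ i)) ≤ℚ M
    bound i p = subst (_≤ℚ M) (dot-indexOf id k a i p) (x₀-max (indexOf id k i p))
    edge : ∀ i → ∃ λ s → ∀ p → root p (triangleCoords a (toℕ i)) ≡ M → OnEdge s p
    edge i = maximizers-on-edge (triangleCoords a (toℕ i)) M
      (proper-face-positive (generators-symmetric id k) X-face X-proper x₀∈X) (bound i)
    σ : Fin k → Fin 6
    σ i = proj₁ (edge i)
    maximal-on-edge : ∀ i p → indexOf id k i p ∈ X → indexOf id k i p ∈ facetOf σ
    maximal-on-edge i p t∈X = onEdge-∈-facetOf σ i p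
      (proj₂ (edge i) p (trans (sym (dot-indexOf id k a i p)) (face-value-constant X-face t∈X x₀∈X)))
    X⊆facetOf : X ⊆ facetOf σ
    X⊆facetOf {t} = indexOf-induction id k {P = λ t → t ∈ X → t ∈ facetOf σ} maximal-on-edge t

  facetOf-injective : ∀ {σ τ} → facetOf σ ≡ facetOf τ → σ ≗ τ
  facetOf-injective {σ} {τ} facetOfσ≡facetOfτ i =
    edge-determined (σ i) (τ i) (on-τ-edge (σ i) (inj₁ refl)) (on-τ-edge (next (σ i)) (inj₂ refl))
    where
    on-τ-edge : ∀ p → OnEdge (σ i) p → root p (normal (τ i)) ≡ 1ℚ
    on-τ-edge p on = to (∈-facetOf τ i p) (subst (indexOf id k i p ∈_) facetOfσ≡facetOfτ (onEdge-∈-facetOf σ i p on))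

proposition5p5 : (k : ℕ) → 1 ≤ k →
    FacetCountIs (sepGens (1 + 2 * k) (windmillEdges k)) (6 ^ k)
proposition5p5 k 1≤k = numFacets-enumerated (facetOf ∘ decode) injective (facetOf-isFacet ∘ decode) onto
  where
  open Windmill k 1≤k
  open Polytope S
  open Faces S
  decode : Fin (6 ^ k) → (Fin k → Fin 6)
  decode = finToFun
  injective : ∀ {c d} → facetOf (decode c) ≡ facetOf (decode d) → c ≡ d
  injective {c} {d} eq = begin
    c                   ≡⟨ funToFin-finToFin {k} {6} c ⟨
    funToFin (decode c) ≡⟨ funToFin-cong (facetOf-injective eq) ⟩
    funToFin (decode d) ≡⟨ funToFin-finToFin {k} {6} d ⟩
    d                   ∎
  onto : ∀ X → IsFacet X → ∃ λ c → X ≡ facetOf (decode c)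
  onto X X-facet = let σ , X≡facetOfσ = facet-is-facetOf X X-facet in
    funToFin σ , trans X≡facetOfσ (facetOf-cong (sym ∘ finToFun-funToFin σ))
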